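{- Let $a>1$ be an integer. If $n$ is an overpseudoprime to base $a$, then $n$ is a strong pseudoprime to base $a$.
   Context: For an integer $m>1$ with $\gcd(m,a)=1$, $h_a(m)$ denotes the multiplicative order of $a$ modulo $m$. The cyclotomic cosets of $a$ modulo $m$ are the orbits of $\{1,2,\ldots,m-1\}$ under $x\mapsto ax\bmod m$; $r_a(m)$ denotes their number. An odd composite number $n$ with $\gcd(n,a)=1$ is called an overpseudoprime to base $a$ if $n=r_a(n)h_a(n)+1$. An odd composite $n$, with $n-1=2^s d$ where $d$ is odd, is a strong pseudoprime to base $a$ if either $a^{d}\equiv 1\pmod n$ or $a^{2^k d}\equiv -1\pmod n$ for some $k$ with $0\le k\le s-1$. -}

module Defs where

open import Data.Nat using (ℕ; zero; suc; _+_; _*_; _∸_; _^_; _≤_; _<_; NonZero)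
open import Data.Nat.DivMod using (_%_)
open import Data.Nat.Primality using (Composite)
open import Data.Nat.Coprimality using (Coprime)
open import Data.List using (List; length)
open import Data.List.Membership.Propositional using (_∈_)
open import Data.List.Relation.Unary.Unique.Propositional using (Unique)
open import Data.Sum using (_⊎_)
open import Data.Product using (Σ; ∃; ∃-syntax; _×_)
open import Relation.Binary.PropositionalEquality using (_≡_)
open import Function.Bundles using (_⇔_)

Odd : ℕ → Set
Odd n = n % 2 ≡ 1

IsOrder : (a m k : ℕ) → .{{_ : NonZero m}} → Set
IsOrder a m k = 0 < k × (a ^ k) % m ≡ 1 % m
              × (∀ j → 0 < j → (a ^ j) % m ≡ 1 % m → k ≤ j)

-- x is the least element of its cyclotomic coset {a^j x mod m | j ∈ ℕ}
-- (the orbit of x under y ↦ a y mod m); such x are canonical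
-- representatives, one per coset.
CosetLeader : (a m x : ℕ) → .{{_ : NonZero m}} → Set
CosetLeader a m x = ∀ j → x ≤ (a ^ j * x) % m

-- r_a(m) = r : the number of cyclotomic cosets of a modulo m on
-- {1,…,m-1} is r, i.e. there is a duplicate-free list consisting exactly
-- of the coset leaders in {1,…,m-1}, of length r.
NumCosets : (a m r : ℕ) → .{{_ : NonZero m}} → Set
NumCosets a m r = ∃[ L ] (Unique L
  × (∀ x → (x ∈ L) ⇔ ((1 ≤ x × x < m) × CosetLeader a m x))
  × length L ≡ r)

Overpseudoprime : (a n : ℕ) → .{{_ : NonZero n}} → Set
Overpseudoprime a n = Odd n × Composite n × Coprime n a
  × ∃[ r ] ∃[ h ] (NumCosets a n r × IsOrder a n h × n ≡ r * h + 1)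

StrongPseudoprime : (a n : ℕ) → .{{_ : NonZero n}} → Set
StrongPseudoprime a n = Odd n × Composite n
  × (∀ s d → n ∸ 1 ≡ 2 ^ s * d → Odd d →
       ((a ^ d) % n ≡ 1 % n)
       ⊎ (∃[ k ] (k < s × (a ^ (2 ^ k * d)) % n ≡ n ∸ 1)))

{-# OPTIONS --safe #-}
module Submission where

-- Let h be the order of a modulo n and r the number of cyclotomic cosets. Choosing the least
-- element of each coset as its leader, (leader ℓ, 0 ≤ j < h) ↦ a^j ℓ mod n maps a set of
-- r h = n − 1 elements onto {1, …, n − 1}, so it is injective: every coset has exactly h
-- elements, i.e. a^e x ≡ x (mod n) with 0 < x < n forces h ∣ e.
-- Now h ∣ n − 1 = 2^s d. If h ∣ d then a^d ≡ 1. Otherwise take k < s with h ∤ 2^k d and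
-- h ∣ 2^(k+1) d; then y = a^(2^k d) satisfies y² ≡ 1, and if y ≢ −1 then g = gcd(n, y − 1) > 1
-- and x = n / g is a nonzero residue with y x ≡ x, contradicting h ∤ 2^k d.

open import Defs
open import Data.Nat using (ℕ; NonZero; zero; suc; _<_; _+_; _*_; _∸_; _^_; _≤_; s≤s; z<s; NonTrivial; >-nonZero; >-nonZero⁻¹; ≢-nonZero⁻¹; n>1⇒nonTrivial; nonTrivial⇒n>1)
open import Data.Nat.Properties
open import Data.Nat.DivMod
open import Data.Nat.Tactic.RingSolver using (solve-∀)
open import Data.Nat.Divisibility using (_∣_; divides; quotient; _∣?_; _∣0; ∣⇒≤; m%n≡0⇒n∣m; n∣m⇒m%n≡0; quotient≢0; quotient-<; m∣n⇒n≡quotient*m)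
open import Data.Nat.GCD using (gcd; gcd[m,n]∣m; gcd[m,n]∣n; gcd[m,n]≢0)
open import Data.Nat.Coprimality using (Coprime; coprime-divisor; coprime?; gcd≡1⇒coprime)
open import Data.Nat.Primality using (composite⇒nonTrivial)
open import Data.Fin.Base as Fin using (Fin; toℕ; combine; remQuot; punchOut)
open import Data.Fin.Properties using (injective⇒≤; punchOut-injective; remQuot-combine; combine-injective; toℕ-fromℕ<; toℕ-injective; toℕ<n) renaming (_≟_ to _≟ᶠ_)
open import Data.List.Base using (List; length; lookup; allFin)
open import Data.List.Extrema.Nat using (argmin; f[argmin]≤f[xs])
open import Data.List.Membership.Propositional using (_∈_)
open import Data.List.Membership.Propositional.Properties using (∈-allFin)
open import Data.List.Relation.Unary.All as All using ()
open import Data.List.Relation.Unary.Any as Any using ()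
open import Data.List.Relation.Unary.Any.Properties using (lookup-index)
open import Data.Product using (∃; ∃-syntax; _×_; _,_; proj₁; proj₂)
open import Data.Sum using (_⊎_; inj₁; inj₂)
open import Function.Base using (_∘_)
open import Function.Bundles using (_⇔_; Equivalence)
open import Function.Definitions using (Injective)
open import Relation.Nullary using (¬_; yes; no; contradiction)
open import Relation.Binary.PropositionalEquality

covering⇒injective : ∀ {m} {A : Set} (f enum : Fin m → A) → Injective _≡_ _≡_ enum →
                     (∀ y → ∃ λ x → f x ≡ enum y) → Injective _≡_ _≡_ f
covering⇒injective {suc m} f enum enum-injective covers {i} {j} fi≡fj with i ≟ᶠ j
... | yes i≡j = i≡j
... | no i≢j = contradiction (injective⇒≤ skip-j-injective) 1+n≰n
  where
  preimageAvoiding-j : ∀ y → ∃ λ x → j ≢ x × f x ≡ enum y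
  preimageAvoiding-j y with covers y
  ... | x , fx≡ey with j ≟ᶠ x
  ...   | yes refl = i , i≢j ∘ sym , trans fi≡fj fx≡ey
  ...   | no j≢x = x , j≢x , fx≡ey

  skip-j : Fin (suc m) → Fin m
  skip-j y = punchOut (proj₁ (proj₂ (preimageAvoiding-j y)))

  skip-j-injective : Injective _≡_ _≡_ skip-j
  skip-j-injective {y} {y′} eq with preimageAvoiding-j y | preimageAvoiding-j y′
  ... | x , j≢x , fx≡ey | x′ , j≢x′ , fx′≡ey′ = enum-injective (begin
    enum y  ≡⟨ sym fx≡ey ⟩
    f x     ≡⟨ cong f (punchOut-injective j≢x j≢x′ eq) ⟩
    f x′    ≡⟨ fx′≡ey′ ⟩
    enum y′ ∎)
    where open ≡-Reasoning

minimizer : ∀ {m} .{{_ : NonZero m}} (f : Fin m → ℕ) → ∃ λ i → ∀ j → f i ≤ f j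
minimizer {suc m} f = argmin f Fin.zero (allFin (suc m)) , λ j →
  All.lookup (f[argmin]≤f[xs] {f = f} Fin.zero (allFin (suc m))) (∈-allFin j)

[m%d*n]%d≡[m*n]%d : ∀ m n d .{{_ : NonZero d}} → (m % d * n) % d ≡ (m * n) % d
[m%d*n]%d≡[m*n]%d m n d = begin
  (m % d * n) % d           ≡⟨ %-distribˡ-* (m % d) n d ⟩
  (m % d % d * (n % d)) % d ≡⟨ cong (λ t → (t * (n % d)) % d) (m%n%n≡m%n m d) ⟩
  (m % d * (n % d)) % d     ≡⟨ %-distribˡ-* m n d ⟨
  (m * n) % d               ∎
  where open ≡-Reasoning

[m*[n%d]]%d≡[m*n]%d : ∀ m n d .{{_ : NonZero d}} → (m * (n % d)) % d ≡ (m * n) % d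
[m*[n%d]]%d≡[m*n]%d m n d = begin
  (m * (n % d)) % d ≡⟨ cong (_% d) (*-comm m (n % d)) ⟩
  (n % d * m) % d   ≡⟨ [m%d*n]%d≡[m*n]%d n m d ⟩
  (n * m) % d       ≡⟨ cong (_% d) (*-comm n m) ⟩
  (m * n) % d       ∎
  where open ≡-Reasoning

[1+m]%n≡1⇒n∣m : ∀ m n .{{_ : NonZero n}} → suc m % n ≡ 1 → n ∣ m
[1+m]%n≡1⇒n∣m m n eq = divides (suc m / n) (suc-injective (begin
  suc m                     ≡⟨ m≡m%n+[m/n]*n (suc m) n ⟩
  suc m % n + suc m / n * n ≡⟨ cong (_+ suc m / n * n) eq ⟩
  suc (suc m / n * n)       ∎))
  where open ≡-Reasoning

cofactor-fixed : ∀ {g n c} .{{_ : NonZero n}} (g∣n : g ∣ n) → g ∣ c →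
                 (suc c * quotient g∣n) % n ≡ quotient g∣n % n
cofactor-fixed {g} {n} {c} g∣n (divides c′ refl) = begin
  (x + c′ * g * x) % n   ≡⟨ cong (λ t → (x + t) % n) (*-assoc c′ g x) ⟩
  (x + c′ * (g * x)) % n ≡⟨ cong (λ t → (x + c′ * t) % n) (trans (*-comm g x) (sym (m∣n⇒n≡quotient*m g∣n))) ⟩
  (x + c′ * n) % n       ≡⟨ [m+kn]%n≡m%n x c′ n ⟩
  x % n                  ∎
  where
  open ≡-Reasoning
  x = quotient g∣n

-- n ∣ (y − 1)(y + 1): either n is coprime to y − 1 and divides y + 1, or g = gcd(n, y − 1) > 1
-- and y fixes n / g.
square≡1⇒≡-1⊎fixes : ∀ {n y} .{{_ : NonZero n}} → y < n → (y * y) % n ≡ 1 →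
                     y ≡ n ∸ 1 ⊎ ∃ λ x → 0 < x × x < n × (y * x) % n ≡ x
square≡1⇒≡-1⊎fixes {n} {zero} _ 0≡1 = contradiction (trans (sym (n∣m⇒m%n≡0 0 n (n ∣0))) 0≡1) λ ()
square≡1⇒≡-1⊎fixes {n} {suc c} 1+c<n y²≡1 with coprime? n c
... | yes n⊥c = inj₁ (cong (_∸ 1) (≤-antisym 1+c<n (∣⇒≤ n∣2+c)))
  where
  square-suc : ∀ c → suc c * suc c ≡ suc (c * (2 + c))
  square-suc = solve-∀

  n∣2+c : n ∣ 2 + c
  n∣2+c = coprime-divisor n⊥c
            ([1+m]%n≡1⇒n∣m (c * (2 + c)) n (subst (λ t → t % n ≡ 1) (square-suc c) y²≡1))
... | no n⊥̸c = inj₂ (x , >-nonZero⁻¹ x , quotient-< g∣n ,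
                     trans (cofactor-fixed g∣n (gcd[m,n]∣n n c)) (m<n⇒m%n≡m (quotient-< g∣n)))
  where
  g∣n = gcd[m,n]∣m n c
  x = quotient g∣n
  instance
    x≢0 : NonZero x
    x≢0 = quotient≢0 g∣n
    g-nonTrivial : NonTrivial (gcd n c)
    g-nonTrivial = n>1⇒nonTrivial (≤∧≢⇒< (n≢0⇒n>0 (gcd[m,n]≢0 n c (inj₁ (≢-nonZero⁻¹ n))))
                                          (n⊥̸c ∘ gcd≡1⇒coprime ∘ sym))

∣2^s*d⇒∣d⊎∃first : ∀ h d s → h ∣ 2 ^ s * d →
                    h ∣ d ⊎ ∃ λ k → k < s × ¬ h ∣ 2 ^ k * d × h ∣ 2 ^ suc k * d
∣2^s*d⇒∣d⊎∃first h d zero    h∣d = inj₁ (subst (h ∣_) (*-identityˡ d) h∣d)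
∣2^s*d⇒∣d⊎∃first h d (suc s) h∣2^[1+s]d with h ∣? 2 ^ s * d
... | no h∤2^sd = inj₂ (s , ≤-refl , h∤2^sd , h∣2^[1+s]d)
... | yes h∣2^sd with ∣2^s*d⇒∣d⊎∃first h d s h∣2^sd
...   | inj₁ h∣d                  = inj₁ h∣d
...   | inj₂ (k , k<s , first)    = inj₂ (k , m≤n⇒m≤1+n k<s , first)

module Action (a n : ℕ) .{{_ : NonZero n}} where

  act : ℕ → ℕ → ℕ
  act e x = (a ^ e * x) % n

  act-< : ∀ e x → act e x < n
  act-< e x = m%n<n (a ^ e * x) n

  act-0 : ∀ {x} → x < n → act 0 x ≡ x
  act-0 {x} x<n = trans (cong (_% n) (*-identityˡ x)) (m<n⇒m%n≡m x<n)

  act-% : ∀ e x → act e (x % n) ≡ act e x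
  act-% e x = [m*[n%d]]%d≡[m*n]%d (a ^ e) x n

  act-+ : ∀ e f x → act e (act f x) ≡ act (e + f) x
  act-+ e f x = begin
    act e (act f x)           ≡⟨ act-% e (a ^ f * x) ⟩
    (a ^ e * (a ^ f * x)) % n ≡⟨ cong (_% n) (*-assoc (a ^ e) (a ^ f) x) ⟨
    (a ^ e * a ^ f * x) % n   ≡⟨ cong (λ t → (t * x) % n) (^-distribˡ-+-* a e f) ⟨
    act (e + f) x             ∎
    where open ≡-Reasoning

  act-comm : ∀ e f x → act e (act f x) ≡ act f (act e x)
  act-comm e f x = trans (act-+ e f x) (trans (cong (λ t → act t x) (+-comm e f)) (sym (act-+ f e x)))

  n∣a^e*x⇒n∣x : Coprime n a → ∀ e x → n ∣ a ^ e * x → n ∣ x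
  n∣a^e*x⇒n∣x _      zero    x n∣x      = subst (n ∣_) (*-identityˡ x) n∣x
  n∣a^e*x⇒n∣x n⊥a (suc e) x n∣a^e*x =
    n∣a^e*x⇒n∣x n⊥a e x (coprime-divisor n⊥a (subst (n ∣_) (*-assoc a (a ^ e) x) n∣a^e*x))

  act-positive : Coprime n a → ∀ e {x} → 0 < x → x < n → 0 < act e x
  act-positive n⊥a e {x} 0<x x<n = n≢0⇒n>0 λ act≡0 →
    <⇒≱ x<n (∣⇒≤ {{>-nonZero 0<x}} (n∣a^e*x⇒n∣x n⊥a e x (m%n≡0⇒n∣m _ n act≡0)))

  module Periodic (h : ℕ) .{{_ : NonZero h}} (a^h≡1 : (a ^ h) % n ≡ 1 % n) where

    act-period : ∀ x → act h x ≡ x % n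
    act-period x = begin
      (a ^ h * x) % n     ≡⟨ [m%d*n]%d≡[m*n]%d (a ^ h) x n ⟨
      (a ^ h % n * x) % n ≡⟨ cong (λ t → (t * x) % n) a^h≡1 ⟩
      (1 % n * x) % n     ≡⟨ [m%d*n]%d≡[m*n]%d 1 x n ⟩
      (1 * x) % n         ≡⟨ cong (_% n) (*-identityˡ x) ⟩
      x % n               ∎
      where open ≡-Reasoning

    act-*period : ∀ k x → act (k * h) x ≡ x % n
    act-*period zero    x = cong (_% n) (*-identityˡ x)
    act-*period (suc k) x = begin
      act (h + k * h) x     ≡⟨ act-+ h (k * h) x ⟨
      act h (act (k * h) x) ≡⟨ cong (act h) (act-*period k x) ⟩
      act h (x % n)         ≡⟨ act-% h x ⟩
      act h x               ≡⟨ act-period x ⟩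
      x % n                 ∎
      where open ≡-Reasoning

    act-%period : ∀ e x → act (e % h) x ≡ act e x
    act-%period e x = begin
      act (e % h) x                     ≡⟨ act-% (e % h) x ⟨
      act (e % h) (x % n)               ≡⟨ cong (act (e % h)) (act-*period (e / h) x) ⟨
      act (e % h) (act (e / h * h) x)   ≡⟨ act-+ (e % h) (e / h * h) x ⟩
      act (e % h + e / h * h) x         ≡⟨ cong (λ t → act t x) (m≡m%n+[m/n]*n e h) ⟨
      act e x                           ∎
      where open ≡-Reasoning

    period∣⇒a^e≡1 : ∀ {e} → h ∣ e → (a ^ e) % n ≡ 1 % n
    period∣⇒a^e≡1 {e} (divides k refl) = begin
      (a ^ (k * h)) % n ≡⟨ cong (_% n) (*-identityʳ (a ^ (k * h))) ⟨
      act (k * h) 1     ≡⟨ act-*period k 1 ⟩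
      1 % n             ∎
      where open ≡-Reasoning

    period∣e+e⇒[a^e]²≡1 : 1 < n → ∀ e → h ∣ e + e → (a ^ e % n * (a ^ e % n)) % n ≡ 1
    period∣e+e⇒[a^e]²≡1 1<n e h∣2e = begin
      (a ^ e % n * (a ^ e % n)) % n ≡⟨ %-distribˡ-* (a ^ e) (a ^ e) n ⟨
      (a ^ e * a ^ e) % n           ≡⟨ cong (_% n) (^-distribˡ-+-* a e e) ⟨
      (a ^ (e + e)) % n             ≡⟨ period∣⇒a^e≡1 h∣2e ⟩
      1 % n                         ≡⟨ m<n⇒m%n≡m 1<n ⟩
      1                             ∎
      where open ≡-Reasoning

module Cosets (a n : ℕ) .{{_ : NonZero n}} (n⊥a : Coprime n a) (L : List ℕ)
              (leaders : ∀ x → (x ∈ L) ⇔ ((1 ≤ x × x < n) × CosetLeader a n x))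
              (h : ℕ) (order : IsOrder a n h) where

  instance
    h≢0 : NonZero h
    h≢0 = >-nonZero (proj₁ order)

  open Action a n
  open Periodic h (proj₁ (proj₂ order))

  record LeaderOf (x : ℕ) : Set where
    field
      toLeader   : ℕ
      leader∈L   : act toLeader x ∈ L
      fromLeader : ℕ
      returns    : act fromLeader (act toLeader x) ≡ x

  leaderOf : ∀ {x} → 0 < x → x < n → LeaderOf x
  leaderOf {x} 0<x x<n = record
    { toLeader   = i
    ; leader∈L   = Equivalence.from (leaders (act i x))
                     ((act-positive n⊥a i 0<x x<n , act-< i x) , leads)
    ; fromLeader = h ∸ i
    ; returns    = returns
    }
    where
    least = minimizer {h} (λ j → act (toℕ j) x)
    i = toℕ (proj₁ least)

    returns : act (h ∸ i) (act i x) ≡ x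
    returns = begin
      act (h ∸ i) (act i x) ≡⟨ act-+ (h ∸ i) i x ⟩
      act (h ∸ i + i) x     ≡⟨ cong (λ t → act t x) (m∸n+n≡m (<⇒≤ (toℕ<n (proj₁ least)))) ⟩
      act h x               ≡⟨ act-period x ⟩
      x % n                 ≡⟨ m<n⇒m%n≡m x<n ⟩
      x                     ∎
      where open ≡-Reasoning

    leads : CosetLeader a n (act i x)
    leads j = begin
      act i x                         ≤⟨ proj₂ least ((j + i) mod h) ⟩
      act (toℕ ((j + i) mod h)) x      ≡⟨ cong (λ t → act t x) (toℕ-fromℕ< (m%n<n (j + i) h)) ⟩
      act ((j + i) % h) x             ≡⟨ act-%period (j + i) x ⟩
      act (j + i) x                   ≡⟨ act-+ j i x ⟨
      act j (act i x)                 ∎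
      where open ≤-Reasoning

  module FullCosets (n≡|L|h+1 : n ≡ length L * h + 1) where

    orbitPoint : Fin (length L * h) → ℕ
    orbitPoint k with remQuot {length L} h k
    ... | u , j = act (toℕ j) (lookup L u)

    orbitPoint-leader : ∀ {ℓ} (ℓ∈L : ℓ ∈ L) e → orbitPoint (combine (Any.index ℓ∈L) (e mod h)) ≡ act e ℓ
    orbitPoint-leader {ℓ} ℓ∈L e = begin
      orbitPoint (combine (Any.index ℓ∈L) (e mod h))
        ≡⟨ cong (λ p → act (toℕ (proj₂ p)) (lookup L (proj₁ p))) (remQuot-combine (Any.index ℓ∈L) (e mod h)) ⟩
      act (toℕ (e mod h)) (lookup L (Any.index ℓ∈L))
        ≡⟨ cong₂ act (toℕ-fromℕ< (m%n<n e h)) (sym (lookup-index ℓ∈L)) ⟩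
      act (e % h) ℓ
        ≡⟨ act-%period e ℓ ⟩
      act e ℓ ∎
      where open ≡-Reasoning

    orbitPoint-covers : ∀ y → ∃ λ k → orbitPoint k ≡ suc (toℕ y)
    orbitPoint-covers y = combine (Any.index leader∈L) (fromLeader mod h) ,
                          trans (orbitPoint-leader leader∈L fromLeader) returns
      where
      y<n : suc (toℕ y) < n
      y<n = subst (suc (toℕ y) <_) (trans (+-comm 1 _) (sym n≡|L|h+1)) (s≤s (toℕ<n y))
      open LeaderOf (leaderOf z<s y<n)

    orbitPoint-injective : Injective _≡_ _≡_ orbitPoint
    orbitPoint-injective = covering⇒injective orbitPoint (suc ∘ toℕ)
                             (toℕ-injective ∘ suc-injective) orbitPoint-covers

    leaderOrbit-injective : ∀ {ℓ} → ℓ ∈ L → ∀ e e′ → act e ℓ ≡ act e′ ℓ → e % h ≡ e′ % h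
    leaderOrbit-injective ℓ∈L e e′ eq = begin
      e % h          ≡⟨ toℕ-fromℕ< (m%n<n e h) ⟨
      toℕ (e mod h)  ≡⟨ cong toℕ (proj₂ (combine-injective u _ u _ (orbitPoint-injective same-point))) ⟩
      toℕ (e′ mod h) ≡⟨ toℕ-fromℕ< (m%n<n e′ h) ⟩
      e′ % h         ∎
      where
      open ≡-Reasoning
      u = Any.index ℓ∈L
      same-point : orbitPoint (combine u (e mod h)) ≡ orbitPoint (combine u (e′ mod h))
      same-point = trans (orbitPoint-leader ℓ∈L e) (trans eq (sym (orbitPoint-leader ℓ∈L e′)))

    stabiliser-trivial : ∀ {x} e → 0 < x → x < n → act e x ≡ x → h ∣ e
    stabiliser-trivial {x} e 0<x x<n fixes = m%n≡0⇒n∣m e h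
      (trans (leaderOrbit-injective leader∈L e 0 fixes-leader) (m<n⇒m%n≡m (proj₁ order)))
      where
      open LeaderOf (leaderOf 0<x x<n)
      open ≡-Reasoning
      fixes-leader : act e (act toLeader x) ≡ act 0 (act toLeader x)
      fixes-leader = begin
        act e (act toLeader x) ≡⟨ act-comm e toLeader x ⟩
        act toLeader (act e x) ≡⟨ cong (act toLeader) fixes ⟩
        act toLeader x         ≡⟨ act-0 (act-< toLeader x) ⟨
        act 0 (act toLeader x) ∎

    period∤e∣e+e⇒a^e≡-1 : 1 < n → ∀ e → ¬ h ∣ e → h ∣ e + e → (a ^ e) % n ≡ n ∸ 1
    period∤e∣e+e⇒a^e≡-1 1<n e h∤e h∣2e
      with square≡1⇒≡-1⊎fixes (m%n<n (a ^ e) n) (period∣e+e⇒[a^e]²≡1 1<n e h∣2e)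
    ... | inj₁ a^e≡-1                 = a^e≡-1
    ... | inj₂ (x , 0<x , x<n , fixes) = contradiction
      (stabiliser-trivial e 0<x x<n (trans (sym ([m%d*n]%d≡[m*n]%d (a ^ e) x n)) fixes)) h∤e

    period∣n∸1 : h ∣ n ∸ 1
    period∣n∸1 = divides (length L) (trans (cong (_∸ 1) n≡|L|h+1) (m+n∸n≡m _ 1))

    strongCondition : 1 < n → ∀ s d → n ∸ 1 ≡ 2 ^ s * d →
                      (a ^ d) % n ≡ 1 % n ⊎ ∃[ k ] (k < s × (a ^ (2 ^ k * d)) % n ≡ n ∸ 1)
    strongCondition 1<n s d n∸1≡2^sd
      with ∣2^s*d⇒∣d⊎∃first h d s (subst (h ∣_) n∸1≡2^sd period∣n∸1)
    ... | inj₁ h∣d                            = inj₁ (period∣⇒a^e≡1 h∣d)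
    ... | inj₂ (k , k<s , h∤2^kd , h∣2^[1+k]d) = inj₂ (k , k<s ,
      period∤e∣e+e⇒a^e≡-1 1<n (2 ^ k * d) h∤2^kd (subst (h ∣_) (doubling (2 ^ k) d) h∣2^[1+k]d))
      where
      doubling : ∀ m d → 2 * m * d ≡ m * d + m * d
      doubling = solve-∀

theorem12 : (a n : ℕ) → .{{_ : NonZero n}} → 1 < a →
            Overpseudoprime a n → StrongPseudoprime a n
theorem12 a n _ (n-odd , n-composite , n⊥a , r , h , (L , _ , leaders , |L|≡r) , order , n≡rh+1) =
  n-odd , n-composite , λ s d n∸1≡2^sd _ → strongCondition (nonTrivial⇒n>1 n) s d n∸1≡2^sd
  where
  instance
    n-nonTrivial : NonTrivial n
    n-nonTrivial = composite⇒nonTrivial n-composite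
  open Cosets a n n⊥a L leaders h order
  open FullCosets (subst (λ r → n ≡ r * h + 1) (sym |L|≡r) n≡rh+1)
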